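{- Let $V$ be a finite set of cardinality $v$ and let $D$ be any block design built on $V$, with blocks $B^1,\dots,B^b$. Then the vector space $V_D=\mathrm{Span}\{\mathcal Z_D(x,y): x,y\in V\}\subseteq\mathbb R^b$ has dimension $v-1$.
   Context: A (balanced incomplete) block design with parameters $(v,b,r,k,\lambda)$ built on a finite set $V$ with $|V|=v$ is a list (repetitions allowed) of $b$ blocks, each a $k$-element subset of $V$ with $k<v$, such that every element of $V$ lies in exactly $r$ blocks and every pair of distinct elements of $V$ lies in exactly $\lambda$ blocks; here $b,r,k,\lambda$ are positive integers, except that the paper also regards the design whose blocks are the $v$ one-element subsets of $V$ (parameters $b=v$, $r=k=1$, $\lambda=0$) as a block design. For $x,y\in V$, $\mathcal Z_D(x,y)\in\mathbb R^b$ is the vector whose $j$-th component is $0$ if both $x,y\in B^j$ or both $x,y\notin B^j$; $1$ if $x\in B^j$ and $y\notin B^j$; $-1$ if $x\notin B^j$ and $y\in B^j$.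
   Formalization: The span $V_D$ and its dimension are taken over ℚ, inside ℚ^b, rather than over ℝ inside ℝ^b. -}

module Defs where

open import Data.Nat using (ℕ; zero; suc; _<_; _∸_)
open import Data.Fin using (Fin; zero; suc)
open import Data.Fin.Subset using (Subset; ∣_∣)
open import Data.Bool using (Bool; true; false; _∧_)
open import Data.Vec using (lookup; tabulate)
open import Data.Product using (Σ; _×_; _,_; ∃)
open import Data.Sum using (_⊎_)
open import Relation.Nullary using (¬_)
open import Relation.Binary.PropositionalEquality using (_≡_)
open import Data.Rational using (ℚ; 0ℚ; 1ℚ; -_; _+_; _*_)

Σℚ : (n : ℕ) → (Fin n → ℚ) → ℚ
Σℚ zero    f = 0ℚ
Σℚ (suc n) f = f zero + Σℚ n (λ i → f (suc i))

Blocks : ℕ → ℕ → Set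
Blocks v b = Fin b → Subset v

blocksContaining : ∀ {v b} → Blocks v b → Fin v → Subset b
blocksContaining B x = tabulate (λ j → lookup (B j) x)

blocksContaining₂ : ∀ {v b} → Blocks v b → Fin v → Fin v → Subset b
blocksContaining₂ B x y = tabulate (λ j → lookup (B j) x ∧ lookup (B j) y)

Regular : (v b r k λ' : ℕ) → Blocks v b → Set
Regular v b r k λ' B =
  (∀ j → ∣ B j ∣ ≡ k) × k < v
  × (∀ x → ∣ blocksContaining B x ∣ ≡ r)
  × (∀ x y → ¬ (x ≡ y) → ∣ blocksContaining₂ B x y ∣ ≡ λ')

-- A block design with parameters (v,b,r,k,λ): b,r,k,λ positive, or the
-- exceptional design of singletons (b = v, r = k = 1, λ = 0).
IsBlockDesign : (v b r k λ' : ℕ) → Blocks v b → Set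
IsBlockDesign v b r k λ' B =
  Regular v b r k λ' B
  × ((0 < b × 0 < r × 0 < k × 0 < λ') ⊎ (b ≡ v × r ≡ 1 × k ≡ 1 × λ' ≡ 0))

IsDesign : (v b : ℕ) → Blocks v b → Set
IsDesign v b B = Σ ℕ λ r → Σ ℕ λ k → Σ ℕ λ λ' → IsBlockDesign v b r k λ' B

Vecℚ : ℕ → Set
Vecℚ b = Fin b → ℚ

zEntry : Bool → Bool → ℚ
zEntry true  true  = 0ℚ
zEntry false false = 0ℚ
zEntry true  false = 1ℚ
zEntry false true  = - 1ℚ

Z : ∀ {v b} → Blocks v b → Fin v → Fin v → Vecℚ b
Z B x y j = zEntry (lookup (B j) x) (lookup (B j) y)

lincomb : ∀ {n b} → (Fin n → ℚ) → (Fin n → Vecℚ b) → Vecℚ b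
lincomb {n} c u j = Σℚ n (λ i → c i * u i j)

InSpan : ∀ {n b} → (Fin n → Vecℚ b) → Vecℚ b → Set
InSpan {n} u w = Σ (Fin n → ℚ) λ c → ∀ j → lincomb c u j ≡ w j

LinIndep : ∀ {n b} → (Fin n → Vecℚ b) → Set
LinIndep {n} u = ∀ (c : Fin n → ℚ) → (∀ j → lincomb c u j ≡ 0ℚ) → ∀ i → c i ≡ 0ℚ

-- Family indexed by pairs (x,y) ∈ V×V, flattened to a function on Fin (v*v)
-- is avoided: we define span membership for the Z-family directly.
InSpanZ : ∀ {v b} → Blocks v b → Vecℚ b → Set
InSpanZ {v} B w =
  Σ (Fin v → Fin v → ℚ) λ c →
    ∀ j → Σℚ v (λ x → Σℚ v (λ y → c x y * Z B x y j)) ≡ w j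

DimVD≡ : ∀ {v b} → Blocks v b → ℕ → Set
DimVD≡ {v} {b} B d =
  Σ (Fin d → Vecℚ b) λ u →
    (∀ i → InSpanZ B (u i)) × LinIndep u × (∀ x y → InSpan u (Z B x y))

{-# OPTIONS --safe #-}
module Submission where

-- Let χₓ ∈ ℚᵇ be the incidence vector of the point x, so that Z(x,y) = χₓ - χ_y
-- and V_D is spanned by the v - 1 differences χₓ - χ₀ (x ≠ 0). These are
-- independent because the Gram matrix of the χₓ is (r - λ) I + λ J: pairing a
-- relation Σ dₓ χₓ = 0 with Σ dₓ = 0 against χ_y leaves (r - λ) d_y = 0, and
-- r > λ because a block through a point misses some other point (k < v).

open import Defs
open import Data.Nat using (ℕ; _∸_)
open import Data.Nat as ℕ using (zero; suc; _<_; s≤s; z≤n)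
import Data.Nat.Properties as ℕ
open import Data.Fin as Fin using (Fin; zero; suc; punchIn)
open import Data.Fin.Properties using (punchInᵢ≢i)
open import Data.Fin.Subset using (Subset; ∣_∣; _∈_; _∉_; _⊂_; Nonempty)
open import Data.Fin.Subset.Properties
  using (p⊂q⇒∣p∣<∣q∣; nonempty?; Empty-unique; ∣⊥∣≡0; ∣∁p∣≡n∸∣p∣; x∈∁p⇒x∉p)
open import Data.Bool using (Bool; true; false; _∧_; if_then_else_)
open import Data.Bool.Properties using (∧-idem; ∧-conicalˡ; ∧-conicalʳ)
open import Data.Vec using ([]; _∷_; lookup; tabulate)
open import Data.Vec.Properties
  using (lookup∘tabulate; tabulate-cong; []=⇒lookup; lookup⇒[]=)
import Data.Vec.Functional as Vector
open import Data.Product using (∃; _,_; map₂)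
open import Data.Sum using (inj₁; inj₂)
open import Function using (_∘_)
open import Relation.Nullary using (does)
open import Relation.Nullary.Decidable using (dec-true; dec-false; decidable-stable)
open import Relation.Binary.PropositionalEquality
open import Algebra.Bundles using (CommutativeRing)
open import Data.Rational
  using (ℚ; 0ℚ; 1ℚ; -_; _+_; _*_; _-_; 1/_; NonZero; Positive; NonNegative)
open import Data.Rational.Properties
open import Data.Rational.Solver using (module +-*-Solver)
open import Algebra.Properties.Semiring.Sum (CommutativeRing.semiring +-*-commutativeRing)
open import Algebra.Properties.Monoid.Mult +-0-monoid using (_×_; ×-homo-+)

open +-*-Solver using (solve; _:=_; _:+_; _:*_; :-_; _:-_; con)
open ≡-Reasoning

Σℚ≡sum : ∀ n (f : Fin n → ℚ) → Σℚ n f ≡ sum f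
Σℚ≡sum zero    f = refl
Σℚ≡sum (suc n) f = cong (f zero +_) (Σℚ≡sum n (f ∘ suc))

neg-distrib-sum : ∀ {n} (f : Fin n → ℚ) → - sum f ≡ ∑[ i < n ] (- f i)
neg-distrib-sum {zero}  f = refl
neg-distrib-sum {suc n} f =
  trans (neg-distrib-+ (f zero) (sum (f ∘ suc))) (cong (- f zero +_) (neg-distrib-sum (f ∘ suc)))

∑-distrib-- : ∀ {n} (f g : Fin n → ℚ) → ∑[ i < n ] (f i - g i) ≡ sum f - sum g
∑-distrib-- f g =
  trans (∑-distrib-+ f (λ i → - g i)) (cong (sum f +_) (sym (neg-distrib-sum g)))

∑-zeros : ∀ {n} {f : Fin n → ℚ} → (∀ i → f i ≡ 0ℚ) → sum f ≡ 0ℚ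
∑-zeros {n} f≡0 = trans (sum-cong-≗ f≡0) (sum-replicate-zero n)

∑-single : ∀ {n} (i : Fin n) (f : Fin n → ℚ) → (∀ k → k ≢ i → f k ≡ 0ℚ) → sum f ≡ f i
∑-single {suc n} i f f≡0 = begin
  sum f                              ≡⟨ sum-remove f ⟩
  f i + sum (λ k → f (punchIn i k))  ≡⟨ cong (f i +_) (∑-zeros (λ k → f≡0 _ (punchInᵢ≢i i k))) ⟩
  f i + 0ℚ                           ≡⟨ +-identityʳ (f i) ⟩
  f i                                ∎

∑-*-constant-except : ∀ {n} (y : Fin n) (g : Fin n → ℚ) (μ : ℚ) → (∀ x → x ≢ y → g x ≡ μ) →
                      (d : Fin n → ℚ) → ∑[ x < n ] (d x * g x) ≡ μ * sum d + d y * (g y - μ)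
∑-*-constant-except {n} y g μ g≡μ d = begin
  ∑[ x < n ] (d x * g x)
    ≡⟨ sum-cong-≗ (λ x → split (d x) (g x) μ) ⟩
  ∑[ x < n ] (μ * d x + d x * (g x - μ))
    ≡⟨ ∑-distrib-+ (λ x → μ * d x) (λ x → d x * (g x - μ)) ⟩
  ∑[ x < n ] (μ * d x) + ∑[ x < n ] (d x * (g x - μ))
    ≡⟨ cong₂ _+_ (sym (*-distribˡ-sum μ d)) (∑-single y _ off-diagonal) ⟩
  μ * sum d + d y * (g y - μ)
    ∎
  where
  split : ∀ a x m → a * x ≡ m * a + a * (x - m)
  split = solve 3 (λ a x m → a :* x := m :* a :+ a :* (x :- m)) refl
  off-diagonal : ∀ x → x ≢ y → d x * (g x - μ) ≡ 0ℚ
  off-diagonal x x≢y = begin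
    d x * (g x - μ)  ≡⟨ cong (λ t → d x * (t - μ)) (g≡μ x x≢y) ⟩
    d x * (μ - μ)    ≡⟨ cong (d x *_) (+-inverseʳ μ) ⟩
    d x * 0ℚ         ≡⟨ *-zeroʳ (d x) ⟩
    0ℚ               ∎

δ : ∀ {n} → Fin n → Fin n → ℚ
δ i k = if does (i Fin.≟ k) then 1ℚ else 0ℚ

∑-δ : ∀ {n} (i : Fin n) (f : Fin n → ℚ) → ∑[ k < n ] (δ i k * f k) ≡ f i
∑-δ i f = trans (∑-single i (λ k → δ i k * f k) off-diagonal) diagonal
  where
  off-diagonal : ∀ k → k ≢ i → δ i k * f k ≡ 0ℚ
  off-diagonal k k≢i rewrite dec-false (i Fin.≟ k) (k≢i ∘ sym) = *-zeroˡ (f k)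
  diagonal : δ i i * f i ≡ f i
  diagonal rewrite dec-true (i Fin.≟ i) refl = *-identityˡ (f i)

differences : ∀ {n b} → (Fin (suc n) → Vecℚ b) → Fin n → Vecℚ b
differences w i j = w (suc i) j - w zero j

coordinates : ∀ {n} → Fin (suc n) → Fin n → ℚ
coordinates zero    _ = 0ℚ
coordinates (suc x)   = δ x

lincomb-coordinates : ∀ {n b} (w : Fin (suc n) → Vecℚ b) x j →
                      lincomb (coordinates x) (differences w) j ≡ w x j - w zero j
lincomb-coordinates {n} w zero j = begin
  lincomb (coordinates zero) (differences w) j  ≡⟨ Σℚ≡sum n _ ⟩
  ∑[ i < n ] (0ℚ * differences w i j)           ≡⟨ ∑-zeros (λ i → *-zeroˡ (differences w i j)) ⟩
  0ℚ                                            ≡⟨ +-inverseʳ (w zero j) ⟨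
  w zero j - w zero j                           ∎
lincomb-coordinates {n} w (suc x) j =
  trans (Σℚ≡sum n _) (∑-δ x (λ i → differences w i j))

lincomb-distrib-- : ∀ {n b} (c c′ : Fin n → ℚ) (u : Fin n → Vecℚ b) j →
                    lincomb (λ i → c i - c′ i) u j ≡ lincomb c u j - lincomb c′ u j
lincomb-distrib-- {n} c c′ u j = begin
  Σℚ n (λ i → (c i - c′ i) * u i j)
    ≡⟨ Σℚ≡sum n _ ⟩
  ∑[ i < n ] ((c i - c′ i) * u i j)
    ≡⟨ sum-cong-≗ (λ i → distrib (c i) (c′ i) (u i j)) ⟩
  ∑[ i < n ] (c i * u i j - c′ i * u i j)
    ≡⟨ ∑-distrib-- (λ i → c i * u i j) (λ i → c′ i * u i j) ⟩
  sum (λ i → c i * u i j) - sum (λ i → c′ i * u i j)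
    ≡⟨ cong₂ _-_ (Σℚ≡sum n _) (Σℚ≡sum n _) ⟨
  lincomb c u j - lincomb c′ u j
    ∎
  where
  distrib : ∀ a a′ x → (a - a′) * x ≡ a * x - a′ * x
  distrib = solve 3 (λ a a′ x → (a :- a′) :* x := a :* x :- a′ :* x) refl

difference∈span-differences : ∀ {n b} (w : Fin (suc n) → Vecℚ b) x y {z : Vecℚ b} →
                              (∀ j → z j ≡ w x j - w y j) → InSpan (differences w) z
difference∈span-differences w x y {z} z≡ =
  (λ i → coordinates x i - coordinates y i) , λ j → begin
    lincomb (λ i → coordinates x i - coordinates y i) (differences w) j
      ≡⟨ lincomb-distrib-- (coordinates x) (coordinates y) (differences w) j ⟩
    lincomb (coordinates x) (differences w) j - lincomb (coordinates y) (differences w) j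
      ≡⟨ cong₂ _-_ (lincomb-coordinates w x j) (lincomb-coordinates w y j) ⟩
    (w x j - w zero j) - (w y j - w zero j)
      ≡⟨ solve 3 (λ a c o → (a :- o) :- (c :- o) := a :- c) refl (w x j) (w y j) (w zero j) ⟩
    w x j - w y j
      ≡⟨ z≡ j ⟨
    z j ∎

AffinelyIndependent : ∀ {n b} → (Fin n → Vecℚ b) → Set
AffinelyIndependent {n} w =
  ∀ (d : Fin n → ℚ) → sum d ≡ 0ℚ → (∀ j → ∑[ x < n ] (d x * w x j) ≡ 0ℚ) → ∀ x → d x ≡ 0ℚ

lincomb-differences : ∀ {n b} (c : Fin n → ℚ) (w : Fin (suc n) → Vecℚ b) j →
                      lincomb c (differences w) j ≡ ∑[ x < suc n ] ((- sum c Vector.∷ c) x * w x j)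
lincomb-differences {n} c w j = begin
  Σℚ n (λ i → c i * (w (suc i) j - w zero j))
    ≡⟨ Σℚ≡sum n _ ⟩
  ∑[ i < n ] (c i * (w (suc i) j - w zero j))
    ≡⟨ sum-cong-≗ (λ i → distrib (c i) _ _) ⟩
  ∑[ i < n ] (c i * w (suc i) j - c i * w zero j)
    ≡⟨ ∑-distrib-- (λ i → c i * w (suc i) j) (λ i → c i * w zero j) ⟩
  S - sum (λ i → c i * w zero j)
    ≡⟨ cong (λ t → S - t) (*-distribʳ-sum (w zero j) c) ⟨
  S - sum c * w zero j
    ≡⟨ rearrange (sum c) (w zero j) S ⟩
  - sum c * w zero j + S
    ∎
  where
  S : ℚ
  S = ∑[ i < n ] (c i * w (suc i) j)
  distrib : ∀ a x o → a * (x - o) ≡ a * x - a * o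
  distrib = solve 3 (λ a x o → a :* (x :- o) := a :* x :- a :* o) refl
  rearrange : ∀ s o t → t - s * o ≡ - s * o + t
  rearrange = solve 3 (λ s o t → t :- s :* o := (:- s) :* o :+ t) refl

affinelyIndependent⇒linIndep : ∀ {n b} (w : Fin (suc n) → Vecℚ b) →
                               AffinelyIndependent w → LinIndep (differences w)
affinelyIndependent⇒linIndep w independent c lincomb≡0 i =
  independent (- sum c Vector.∷ c) (+-inverseˡ (sum c))
              (λ j → trans (sym (lincomb-differences c w j)) (lincomb≡0 j)) (suc i)

⟨_,_⟩ : ∀ {b} → Vecℚ b → Vecℚ b → ℚ
⟨_,_⟩ {b} u w = ∑[ j < b ] (u j * w j)

∑-*-⟨⟩ : ∀ {n b} (d : Fin n → ℚ) (w : Fin n → Vecℚ b) (v : Vecℚ b) →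
         ∑[ x < n ] (d x * ⟨ w x , v ⟩) ≡ ∑[ j < b ] (∑[ x < n ] (d x * w x j) * v j)
∑-*-⟨⟩ {n} {b} d w v = begin
  ∑[ x < n ] (d x * ∑[ j < b ] (w x j * v j))
    ≡⟨ sum-cong-≗ (λ x → *-distribˡ-sum (d x) (λ j → w x j * v j)) ⟩
  ∑[ x < n ] ∑[ j < b ] (d x * (w x j * v j))
    ≡⟨ ∑-comm (λ x j → d x * (w x j * v j)) ⟩
  ∑[ j < b ] ∑[ x < n ] (d x * (w x j * v j))
    ≡⟨ sum-cong-≗ (λ j → sum-cong-≗ (λ x → *-assoc (d x) (w x j) (v j))) ⟨
  ∑[ j < b ] ∑[ x < n ] (d x * w x j * v j)
    ≡⟨ sum-cong-≗ (λ j → *-distribʳ-sum (v j) (λ x → d x * w x j)) ⟨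
  ∑[ j < b ] (∑[ x < n ] (d x * w x j) * v j)
    ∎

p*q≡0⇒p≡0 : ∀ p q .{{_ : NonZero q}} → p * q ≡ 0ℚ → p ≡ 0ℚ
p*q≡0⇒p≡0 p q p*q≡0 = begin
  p                 ≡⟨ *-identityʳ p ⟨
  p * 1ℚ            ≡⟨ cong (p *_) (*-inverseʳ q) ⟨
  p * (q * (1/ q))  ≡⟨ *-assoc p q (1/ q) ⟨
  (p * q) * (1/ q)  ≡⟨ cong (_* (1/ q)) p*q≡0 ⟩
  0ℚ * (1/ q)       ≡⟨ *-zeroˡ (1/ q) ⟩
  0ℚ                ∎

gram⇒affinelyIndependent : ∀ {n b} (w : Fin n → Vecℚ b) (ρ μ : ℚ) .{{_ : NonZero (ρ - μ)}} →
                           (∀ x → ⟨ w x , w x ⟩ ≡ ρ) → (∀ x y → x ≢ y → ⟨ w x , w y ⟩ ≡ μ) →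
                           AffinelyIndependent w
gram⇒affinelyIndependent {n} {b} w ρ μ diagonal off-diagonal d ∑d≡0 ∑dw≡0 y =
  p*q≡0⇒p≡0 (d y) (ρ - μ) (begin
    d y * (ρ - μ)
      ≡⟨ +-identityˡ _ ⟨
    0ℚ + d y * (ρ - μ)
      ≡⟨ cong₂ (λ s t → s + d y * (t - μ)) (trans (cong (μ *_) ∑d≡0) (*-zeroʳ μ)) (diagonal y) ⟨
    μ * sum d + d y * (⟨ w y , w y ⟩ - μ)
      ≡⟨ ∑-*-constant-except y (λ x → ⟨ w x , w y ⟩) μ (λ x x≢y → off-diagonal x y x≢y) d ⟨
    ∑[ x < n ] (d x * ⟨ w x , w y ⟩)
      ≡⟨ ∑-*-⟨⟩ d w (w y) ⟩
    ∑[ j < b ] (∑[ x < n ] (d x * w x j) * w y j)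
      ≡⟨ ∑-zeros (λ j → trans (cong (_* w y j) (∑dw≡0 j)) (*-zeroˡ (w y j))) ⟩
    0ℚ
      ∎)

∣p∣>0⇒nonempty : ∀ {n} {p : Subset n} → 0 < ∣ p ∣ → Nonempty p
∣p∣>0⇒nonempty {n} {p} 0<∣p∣ = decidable-stable (nonempty? p) λ empty →
  ℕ.<⇒≢ 0<∣p∣ (sym (trans (cong ∣_∣ (Empty-unique empty)) (∣⊥∣≡0 n)))

∣p∣<n⇒nonfull : ∀ {n} {p : Subset n} → ∣ p ∣ < n → ∃ λ x → x ∉ p
∣p∣<n⇒nonfull {n} {p} ∣p∣<n =
  map₂ x∈∁p⇒x∉p (∣p∣>0⇒nonempty (subst (0 <_) (sym (∣∁p∣≡n∸∣p∣ p)) (ℕ.m<n⇒0<n∸m ∣p∣<n)))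

∈-blocksContaining⁺ : ∀ {v b} (B : Blocks v b) {x j} → x ∈ B j → j ∈ blocksContaining B x
∈-blocksContaining⁺ B {x} {j} x∈Bj =
  lookup⇒[]= j _ (trans (lookup∘tabulate (λ i → lookup (B i) x) j) ([]=⇒lookup x∈Bj))

∈-blocksContaining⁻ : ∀ {v b} (B : Blocks v b) {x j} → j ∈ blocksContaining B x → x ∈ B j
∈-blocksContaining⁻ B {x} {j} j∈ =
  lookup⇒[]= x (B j) (trans (sym (lookup∘tabulate (λ i → lookup (B i) x) j)) ([]=⇒lookup j∈))

blocksContaining₂⊂blocksContaining : ∀ {v b} (B : Blocks v b) {x z j} → x ∈ B j → z ∉ B j →
                                     blocksContaining₂ B x z ⊂ blocksContaining B x
blocksContaining₂⊂blocksContaining B {x} {z} {j} x∈Bj z∉Bj =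
  shrink , j , ∈-blocksContaining⁺ B x∈Bj , z∉Bj ∘ z∈Bj
  where
  both : ∀ {i} → i ∈ blocksContaining₂ B x z → lookup (B i) x ∧ lookup (B i) z ≡ true
  both {i} i∈ =
    trans (sym (lookup∘tabulate (λ k → lookup (B k) x ∧ lookup (B k) z) i)) ([]=⇒lookup i∈)
  shrink : ∀ {i} → i ∈ blocksContaining₂ B x z → i ∈ blocksContaining B x
  shrink {i} i∈ = ∈-blocksContaining⁺ B (lookup⇒[]= x (B i) (∧-conicalˡ _ _ (both i∈)))
  z∈Bj : j ∈ blocksContaining₂ B x z → z ∈ B j
  z∈Bj j∈ = lookup⇒[]= z (B j) (∧-conicalʳ _ _ (both j∈))

regular⇒λ<r : ∀ {v b r k λ'} (B : Blocks v b) → Regular v b r k λ' B → 0 < r → λ' < r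
regular⇒λ<r {zero}  B (_ , () , _)
regular⇒λ<r {suc n} B (sizes , k<v , replication , pairs) 0<r
  with j , j∈ ← ∣p∣>0⇒nonempty (subst (0 <_) (sym (replication zero)) 0<r)
  with z , z∉Bj ← ∣p∣<n⇒nonfull (subst (_< suc n) (sym (sizes j)) k<v)
  = subst₂ _<_ (pairs zero z 0≢z) (replication zero)
           (p⊂q⇒∣p∣<∣q∣ (blocksContaining₂⊂blocksContaining B 0∈Bj z∉Bj))
  where
  0∈Bj : zero ∈ B j
  0∈Bj = ∈-blocksContaining⁻ B j∈
  0≢z : zero ≢ z
  0≢z refl = z∉Bj 0∈Bj

isBlockDesign⇒0<r : ∀ {v b r k λ'} {B : Blocks v b} → IsBlockDesign v b r k λ' B → 0 < r
isBlockDesign⇒0<r (_ , inj₁ (_ , 0<r , _)) = 0<r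
isBlockDesign⇒0<r (_ , inj₂ (_ , refl , _)) = s≤s z≤n

×1-nonNegative : ∀ n → NonNegative (n × 1ℚ)
×1-nonNegative zero    = _
×1-nonNegative (suc n) = nonNeg+nonNeg⇒nonNeg 1ℚ (n × 1ℚ) {{×1-nonNegative n}}

m<n⇒n×1-m×1-positive : ∀ {m n} → m < n → Positive (n × 1ℚ - m × 1ℚ)
m<n⇒n×1-m×1-positive {m} {n} m<n =
  subst Positive (sym n×1-m×1≡) (pos+nonNeg⇒pos 1ℚ (t × 1ℚ) {{×1-nonNegative t}})
  where
  t : ℕ
  t = n ∸ suc m
  n×1-m×1≡ : n × 1ℚ - m × 1ℚ ≡ 1ℚ + t × 1ℚ
  n×1-m×1≡ = begin
    n × 1ℚ - m × 1ℚ
      ≡⟨ cong (λ l → l × 1ℚ - m × 1ℚ) (ℕ.m+[n∸m]≡n m<n) ⟨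
    1ℚ + (m ℕ.+ t) × 1ℚ - m × 1ℚ
      ≡⟨ cong (λ q → 1ℚ + q - m × 1ℚ) (×-homo-+ 1ℚ m t) ⟩
    1ℚ + (m × 1ℚ + t × 1ℚ) - m × 1ℚ
      ≡⟨ solve 2 (λ a c → con 1ℚ :+ (a :+ c) :- a := con 1ℚ :+ c) refl (m × 1ℚ) (t × 1ℚ) ⟩
    1ℚ + t × 1ℚ
      ∎

χ : Bool → ℚ
χ true  = 1ℚ
χ false = 0ℚ

χ-∧ : ∀ a c → χ a * χ c ≡ χ (a ∧ c)
χ-∧ true  c = *-identityˡ (χ c)
χ-∧ false c = *-zeroˡ (χ c)

∑χ-lookup : ∀ {n} (p : Subset n) → ∑[ j < n ] χ (lookup p j) ≡ ∣ p ∣ × 1ℚ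
∑χ-lookup []          = refl
∑χ-lookup (true ∷ p)  = cong (1ℚ +_) (∑χ-lookup p)
∑χ-lookup (false ∷ p) = trans (+-identityˡ _) (∑χ-lookup p)

indicator : ∀ {v b} → Blocks v b → Fin v → Vecℚ b
indicator B x j = χ (lookup (B j) x)

Z≡indicator-difference : ∀ {v b} (B : Blocks v b) x y j →
                         Z B x y j ≡ indicator B x j - indicator B y j
Z≡indicator-difference B x y j = zEntry≡χ-χ (lookup (B j) x) (lookup (B j) y)
  where
  zEntry≡χ-χ : ∀ a c → zEntry a c ≡ χ a - χ c
  zEntry≡χ-χ true  true  = refl
  zEntry≡χ-χ true  false = refl
  zEntry≡χ-χ false true  = refl
  zEntry≡χ-χ false false = refl

⟨indicator,indicator⟩ : ∀ {v b} (B : Blocks v b) x y →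
                        ⟨ indicator B x , indicator B y ⟩ ≡ ∣ blocksContaining₂ B x y ∣ × 1ℚ
⟨indicator,indicator⟩ {b = b} B x y = begin
  ∑[ j < b ] (χ (lookup (B j) x) * χ (lookup (B j) y))
    ≡⟨ sum-cong-≗ (λ j → χ-∧ (lookup (B j) x) (lookup (B j) y)) ⟩
  ∑[ j < b ] χ (both j)
    ≡⟨ sum-cong-≗ (λ j → cong χ (lookup∘tabulate both j)) ⟨
  ∑[ j < b ] χ (lookup (tabulate both) j)
    ≡⟨ ∑χ-lookup (tabulate both) ⟩
  ∣ tabulate both ∣ × 1ℚ
    ∎
  where
  both : Fin b → Bool
  both j = lookup (B j) x ∧ lookup (B j) y

blocksContaining₂-diagonal : ∀ {v b} (B : Blocks v b) x →
                             blocksContaining₂ B x x ≡ blocksContaining B x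
blocksContaining₂-diagonal B x = tabulate-cong (λ j → ∧-idem (lookup (B j) x))

Z∈InSpanZ : ∀ {v b} (B : Blocks v b) x y → InSpanZ B (Z B x y)
Z∈InSpanZ {v} B x y = (λ x′ y′ → δ x x′ * δ y y′) , λ j → begin
  Σℚ v (λ x′ → Σℚ v (λ y′ → δ x x′ * δ y y′ * Z B x′ y′ j))
    ≡⟨ Σℚ≡sum v _ ⟩
  ∑[ x′ < v ] Σℚ v (λ y′ → δ x x′ * δ y y′ * Z B x′ y′ j)
    ≡⟨ sum-cong-≗ (λ x′ → pull-out x′ j) ⟩
  ∑[ x′ < v ] (δ x x′ * ∑[ y′ < v ] (δ y y′ * Z B x′ y′ j))
    ≡⟨ ∑-δ x (λ x′ → ∑[ y′ < v ] (δ y y′ * Z B x′ y′ j)) ⟩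
  ∑[ y′ < v ] (δ y y′ * Z B x y′ j)
    ≡⟨ ∑-δ y (λ y′ → Z B x y′ j) ⟩
  Z B x y j
    ∎
  where
  pull-out : ∀ x′ j → Σℚ v (λ y′ → δ x x′ * δ y y′ * Z B x′ y′ j)
                    ≡ δ x x′ * ∑[ y′ < v ] (δ y y′ * Z B x′ y′ j)
  pull-out x′ j = trans (Σℚ≡sum v _)
    (trans (sum-cong-≗ (λ y′ → *-assoc (δ x x′) (δ y y′) (Z B x′ y′ j)))
           (sym (*-distribˡ-sum (δ x x′) (λ y′ → δ y y′ * Z B x′ y′ j))))

lemma5 : (v b : ℕ) (B : Blocks v b) → IsDesign v b B → DimVD≡ B (v ∸ 1)
lemma5 zero    b B (_ , _ , _ , (_ , () , _) , _)
lemma5 (suc n) b B (r , k , λ' , design@(regular@(_ , _ , replication , pairs) , _)) =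
  differences w , basis∈VD , independent , Z∈span
  where
  w : Fin (suc n) → Vecℚ b
  w = indicator B
  λ<r : λ' < r
  λ<r = regular⇒λ<r B regular (isBlockDesign⇒0<r {B = B} design)
  instance
    r-λ≢0 : NonZero (r × 1ℚ - λ' × 1ℚ)
    r-λ≢0 = pos⇒nonZero (r × 1ℚ - λ' × 1ℚ) {{m<n⇒n×1-m×1-positive λ<r}}
  diagonal : ∀ x → ⟨ w x , w x ⟩ ≡ r × 1ℚ
  diagonal x = trans (⟨indicator,indicator⟩ B x x)
                     (cong (_× 1ℚ) (trans (cong ∣_∣ (blocksContaining₂-diagonal B x)) (replication x)))
  off-diagonal : ∀ x y → x ≢ y → ⟨ w x , w y ⟩ ≡ λ' × 1ℚ
  off-diagonal x y x≢y = trans (⟨indicator,indicator⟩ B x y) (cong (_× 1ℚ) (pairs x y x≢y))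
  basis∈VD : ∀ i → InSpanZ B (differences w i)
  basis∈VD i with c , lincomb≡Z ← Z∈InSpanZ B (suc i) zero =
    c , λ j → trans (lincomb≡Z j) (Z≡indicator-difference B (suc i) zero j)
  independent : LinIndep (differences w)
  independent = affinelyIndependent⇒linIndep w
    (gram⇒affinelyIndependent w (r × 1ℚ) (λ' × 1ℚ) diagonal off-diagonal)
  Z∈span : ∀ x y → InSpan (differences w) (Z B x y)
  Z∈span x y = difference∈span-differences w x y (Z≡indicator-difference B x y)
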